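{- There are $\Omega((\sqrt{2})^i)$ integers $N$ with $2^{i-1} \le N < 2^i$ (i.e., $i$-bit integers) that can be written as $N = A/B$ with $A, B$ antipalindromic numbers.
   Context: A positive integer is antipalindromic if its base-$2$ representation (without leading zeros) $w_1 \cdots w_{2m}$ has even length and satisfies $w_i + w_{2m+1-i} = 1$ for all $i$ (the second half is the reverse complement of the first half). The asymptotic bound is as $i \to \infty$. -}

module Defs where

open import Data.Nat using (ℕ; zero; suc; _+_; _*_; _^_; _≤_; _<_)
open import Data.Bool using (Bool; true; false; not)
open import Data.Fin using (Fin; zero; opposite)
open import Data.Vec using (Vec; lookup; toList)
open import Data.List using (List; foldl)
open import Data.Product using (Σ; _×_; ∃; ∃-syntax)
open import Relation.Binary.PropositionalEquality using (_≡_)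

bit : Bool → ℕ
bit true  = 1
bit false = 0

value : ∀ {n} → Vec Bool n → ℕ
value w = foldl (λ acc b → 2 * acc + bit b) 0 (toList w)

-- n is antipalindromic: its base-2 representation (without leading zeros,
-- i.e. leading bit 1) is a word w of even length 2m (m ≥ 1) with
-- w_i + w_{2m+1-i} = 1 for all i  (opposite i is the mirrored index).
Antipalindromic : ℕ → Set
Antipalindromic n =
  ∃[ k ] Σ (Vec Bool (suc k + suc k)) λ w →
    (lookup w zero ≡ true) × (value w ≡ n) ×
    (∀ (i : Fin (suc k + suc k)) → bit (lookup w i) + bit (lookup w (opposite i)) ≡ 1)

AntipalQuotient : ℕ → Set
AntipalQuotient N = ∃[ A ] ∃[ B ] Antipalindromic A × Antipalindromic B × (A ≡ N * B)

-- For a bit word r let u = 1r(1r)ᴿ, a palindrome with value U. Then A = u ū (ū the bitwise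
-- complement of u) is antipalindromic with value (U + 1)(2^|u| − 1), and B = (10)^(|r|+1) is
-- antipalindromic with 3B = 2(2^|u| − 1); hence A/B = 3(U + 1)/2 = 3(val(1 r rᴿ) + 1), and this
-- quotient determines r. Fixing a two-bit prefix 00 or 11 of r and letting its last m bits vary
-- gives 2^m distinct quotients whose bit length is exactly 6 + 2m, resp. 7 + 2m.
module Submission where

open import Defs
open import Data.Nat using (ℕ; zero; suc; _+_; _*_; _^_; _≤_; _<_; _∸_)
open import Data.Nat.Properties
open import Data.Nat.Tactic.RingSolver using (solve-∀)
open import Data.Bool using (Bool; true; false; not)
open import Data.List using (List; []; _∷_; _++_; length; map; reverse; foldl)
import Data.List.Properties as List
open import Data.Vec as Vec using (Vec; _∷ʳ_; lookup; toList)
import Data.Vec.Properties as Vec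
open import Data.Fin using (Fin; zero; suc; opposite; fromℕ; inject₁)
open import Data.Bool.Properties using (not-involutive)
open import Function using (_∘_)
open import Data.Product using (_×_; _,_; proj₁; proj₂; ∃-syntax)
open import Relation.Binary.PropositionalEquality
open import Relation.Binary.Definitions using (tri<; tri≈; tri>)
open import Data.Sum using (_⊎_; inj₁; inj₂)
open import Data.Empty using (⊥; ⊥-elim)
open import Data.List.Membership.Propositional using (_∈_)
open import Data.List.Relation.Unary.All as All using (All)
import Data.List.Relation.Unary.All.Properties as All
open import Data.List.Relation.Unary.Unique.Propositional using (Unique)
import Data.List.Relation.Unary.Unique.Propositional.Properties as Unique
import Data.List.Relation.Unary.AllPairs as AllPairs
open import Data.List.Membership.Propositional.Properties using (∈-map⁻)

push : ℕ → Bool → ℕ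
push acc b = 2 * acc + bit b

val : List Bool → ℕ
val = foldl push 0

foldl-push : ∀ acc xs → foldl push acc xs ≡ acc * 2 ^ length xs + val xs
foldl-push acc []       = sym (trans (+-identityʳ _) (*-identityʳ acc))
foldl-push acc (x ∷ xs) = begin
  foldl push (2 * acc + bit x) xs                   ≡⟨ foldl-push (2 * acc + bit x) xs ⟩
  (2 * acc + bit x) * 2 ^ length xs + val xs        ≡⟨ regroup acc (bit x) (2 ^ length xs) (val xs) ⟩
  acc * 2 ^ length (x ∷ xs) + (bit x * 2 ^ length xs + val xs)
                                                    ≡⟨ cong (acc * 2 ^ length (x ∷ xs) +_) (foldl-push (bit x) xs) ⟨
  acc * 2 ^ length (x ∷ xs) + val (x ∷ xs)          ∎
  where
  open ≡-Reasoning
  regroup : ∀ a b p v → (2 * a + b) * p + v ≡ a * (2 * p) + (b * p + v)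
  regroup = solve-∀

val-++ : ∀ xs ys → val (xs ++ ys) ≡ val xs * 2 ^ length ys + val ys
val-++ xs ys = trans (List.foldl-++ push 0 xs ys) (foldl-push (val xs) ys)

val-∷ : ∀ x xs → val (x ∷ xs) ≡ bit x * 2 ^ length xs + val xs
val-∷ x = val-++ (x ∷ [])

bit-not : ∀ b → bit (not b) + bit b ≡ 1
bit-not true  = refl
bit-not false = refl

val-complement : ∀ xs → val (map not xs) + val xs + 1 ≡ 2 ^ length xs
val-complement []       = refl
val-complement (x ∷ xs) = begin
  val (not x ∷ map not xs) + val (x ∷ xs) + 1
    ≡⟨ cong₂ (λ u v → u + v + 1) (val-∷ (not x) (map not xs)) (val-∷ x xs) ⟩
  bit (not x) * 2 ^ length (map not xs) + val (map not xs) + (bit x * P + val xs) + 1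
    ≡⟨ cong (λ l → bit (not x) * 2 ^ l + val (map not xs) + (bit x * P + val xs) + 1) (List.length-map not xs) ⟩
  bit (not x) * P + val (map not xs) + (bit x * P + val xs) + 1
    ≡⟨ regroup (bit (not x)) (bit x) P (val (map not xs)) (val xs) ⟩
  (bit (not x) + bit x) * P + (val (map not xs) + val xs + 1)
    ≡⟨ cong₂ (λ c v → c * P + v) (bit-not x) (val-complement xs) ⟩
  1 * P + P
    ≡⟨ +-comm (1 * P) P ⟩
  2 * P ∎
  where
  open ≡-Reasoning
  P = 2 ^ length xs
  regroup : ∀ a b p u v → a * p + u + (b * p + v) + 1 ≡ (a + b) * p + (u + v + 1)
  regroup = solve-∀

val< : ∀ xs → val xs < 2 ^ length xs
val< xs = subst (val xs <_) (val-complement xs)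
  (subst (_≤ val (map not xs) + val xs + 1) (+-comm (val xs) 1)
    (+-monoˡ-≤ 1 (m≤n+m (val xs) (val (map not xs)))))

val-++-bounds : ∀ xs ys →
  val xs * 2 ^ length ys ≤ val (xs ++ ys) × val (xs ++ ys) < suc (val xs) * 2 ^ length ys
val-++-bounds xs ys rewrite val-++ xs ys =
  m≤m+n (val xs * P) (val ys) ,
  subst (val xs * P + val ys <_) (+-comm (val xs * P) P) (+-monoʳ-< (val xs * P) (val< ys))
  where P = 2 ^ length ys

val-++-monoˡ-< : ∀ {xs xs' ys ys'} → length ys ≡ length ys' →
  val xs < val xs' → val (xs ++ ys) < val (xs' ++ ys')
val-++-monoˡ-< {xs} {xs'} {ys} {ys'} len lt = begin-strict
  val (xs ++ ys)               <⟨ proj₂ (val-++-bounds xs ys) ⟩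
  suc (val xs) * 2 ^ length ys ≤⟨ *-monoˡ-≤ _ lt ⟩
  val xs' * 2 ^ length ys      ≡⟨ cong (λ l → val xs' * 2 ^ l) len ⟩
  val xs' * 2 ^ length ys'     ≤⟨ proj₁ (val-++-bounds xs' ys') ⟩
  val (xs' ++ ys')             ∎
  where open ≤-Reasoning

val-++-injectiveˡ : ∀ {xs xs' ys ys'} → length ys ≡ length ys' →
  val (xs ++ ys) ≡ val (xs' ++ ys') → val xs ≡ val xs'
val-++-injectiveˡ {xs} {xs'} {ys} {ys'} len eq with <-cmp (val xs) (val xs')
... | tri< lt _ _ = ⊥-elim (<-irrefl eq (val-++-monoˡ-< {xs} {xs'} {ys} {ys'} len lt))
... | tri≈ _ e _  = e
... | tri> _ _ gt = ⊥-elim (<-irrefl (sym eq) (val-++-monoˡ-< {xs'} {xs} {ys'} {ys} (sym len) gt))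

bit-injective : ∀ {x y} → bit x ≡ bit y → x ≡ y
bit-injective {true}  {true}  _ = refl
bit-injective {false} {false} _ = refl

val-injective : ∀ {xs ys} → length xs ≡ length ys → val xs ≡ val ys → xs ≡ ys
val-injective {[]}     {[]}     _   _  = refl
val-injective {x ∷ xs} {y ∷ ys} len eq =
  cong₂ _∷_ (bit-injective same-head) (val-injective len′ same-tail)
  where
  len′ : length xs ≡ length ys
  len′ = suc-injective len
  same-head : bit x ≡ bit y
  same-head = val-++-injectiveˡ {x ∷ []} {y ∷ []} {xs} {ys} len′ eq
  same-tail : val xs ≡ val ys
  same-tail = +-cancelˡ-≡ (bit x * 2 ^ length xs) _ _ (begin
    bit x * 2 ^ length xs + val xs ≡⟨ val-∷ x xs ⟨
    val (x ∷ xs)                   ≡⟨ eq ⟩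
    val (y ∷ ys)                   ≡⟨ val-∷ y ys ⟩
    bit y * 2 ^ length ys + val ys ≡⟨ cong₂ (λ b l → b * 2 ^ l + val ys) same-head len′ ⟨
    bit x * 2 ^ length xs + val ys ∎)
    where open ≡-Reasoning

val-true-∷-bounds : ∀ xs → 2 ^ length xs ≤ val (true ∷ xs) × val (true ∷ xs) < 2 ^ suc (length xs)
val-true-∷-bounds xs =
  subst (_≤ val (true ∷ xs)) (*-identityˡ _) (proj₁ (val-++-bounds (true ∷ []) xs)) ,
  proj₂ (val-++-bounds (true ∷ []) xs)

val-true-∷-monoˡ-< : ∀ {xs ys} → length xs < length ys → val (true ∷ xs) < val (true ∷ ys)
val-true-∷-monoˡ-< {xs} {ys} lt = begin-strict
  val (true ∷ xs)       <⟨ proj₂ (val-true-∷-bounds xs) ⟩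
  2 ^ suc (length xs)   ≤⟨ ^-monoʳ-≤ 2 lt ⟩
  2 ^ length ys         ≤⟨ proj₁ (val-true-∷-bounds ys) ⟩
  val (true ∷ ys)       ∎
  where open ≤-Reasoning

val-true-∷-injective : ∀ {xs ys} → val (true ∷ xs) ≡ val (true ∷ ys) → xs ≡ ys
val-true-∷-injective {xs} {ys} eq = List.∷-injectiveʳ (val-injective (cong suc same-length) eq)
  where
  same-length : length xs ≡ length ys
  same-length with <-cmp (length xs) (length ys)
  ... | tri< lt _ _ = ⊥-elim (<-irrefl eq (val-true-∷-monoˡ-< {xs} {ys} lt))
  ... | tri≈ _ e _  = e
  ... | tri> _ _ gt = ⊥-elim (<-irrefl (sym eq) (val-true-∷-monoˡ-< {ys} {xs} gt))

val-++-complement : ∀ u → val (u ++ map not u) + suc (val u) ≡ suc (val u) * 2 ^ length u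
val-++-complement u = begin
  val (u ++ map not u) + suc (val u)
    ≡⟨ cong (_+ suc (val u)) (val-++ u (map not u)) ⟩
  val u * 2 ^ length (map not u) + val (map not u) + suc (val u)
    ≡⟨ cong (λ l → val u * 2 ^ l + val (map not u) + suc (val u)) (List.length-map not u) ⟩
  val u * P + val (map not u) + suc (val u)
    ≡⟨ regroup (val u) P (val (map not u)) ⟩
  val u * P + (val (map not u) + val u + 1)
    ≡⟨ cong (val u * P +_) (val-complement u) ⟩
  val u * P + P
    ≡⟨ +-comm (val u * P) P ⟩
  suc (val u) * P ∎
  where
  open ≡-Reasoning
  P = 2 ^ length u
  regroup : ∀ a p v → a * p + v + suc a ≡ a * p + (v + a + 1)
  regroup = solve-∀

lookup-∷ʳ-last : ∀ {A : Set} {n} (xs : Vec A n) x → lookup (xs ∷ʳ x) (fromℕ n) ≡ x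
lookup-∷ʳ-last Vec.[]       x = refl
lookup-∷ʳ-last (_ Vec.∷ xs) x = lookup-∷ʳ-last xs x

lookup-∷ʳ-inject₁ : ∀ {A : Set} {n} (xs : Vec A n) x (i : Fin n) →
  lookup (xs ∷ʳ x) (inject₁ i) ≡ lookup xs i
lookup-∷ʳ-inject₁ (_ Vec.∷ xs) x zero    = refl
lookup-∷ʳ-inject₁ (_ Vec.∷ xs) x (suc i) = lookup-∷ʳ-inject₁ xs x i

lookup-reverse-opposite : ∀ {A : Set} {n} (xs : Vec A n) (i : Fin n) →
  lookup (Vec.reverse xs) (opposite i) ≡ lookup xs i
lookup-reverse-opposite (x Vec.∷ xs) zero    =
  trans (cong (λ v → lookup v (fromℕ _)) (Vec.reverse-∷ x xs)) (lookup-∷ʳ-last (Vec.reverse xs) x)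
lookup-reverse-opposite (x Vec.∷ xs) (suc i) = begin
  lookup (Vec.reverse (x Vec.∷ xs)) (inject₁ (opposite i)) ≡⟨ cong (λ v → lookup v (inject₁ (opposite i))) (Vec.reverse-∷ x xs) ⟩
  lookup (Vec.reverse xs ∷ʳ x) (inject₁ (opposite i))      ≡⟨ lookup-∷ʳ-inject₁ (Vec.reverse xs) x (opposite i) ⟩
  lookup (Vec.reverse xs) (opposite i)                     ≡⟨ lookup-reverse-opposite xs i ⟩
  lookup xs i                                              ∎
  where open ≡-Reasoning

reverseComplement : List Bool → List Bool
reverseComplement = map not ∘ reverse

antipalindromic-val : ∀ k r → length (true ∷ r) ≡ suc k + suc k →
  reverseComplement (true ∷ r) ≡ true ∷ r → Antipalindromic (val (true ∷ r))
antipalindromic-val k r len anti = k , w , refl , cong val toList-w , complementary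
  where
  w : Vec Bool (suc k + suc k)
  w = Vec.cast len (Vec.fromList (true ∷ r))
  toList-w : toList w ≡ true ∷ r
  toList-w = trans (Vec.toList-cast len _) (Vec.toList∘fromList _)
  anti-w : Vec.map not (Vec.reverse w) ≡ w
  anti-w = trans (sym (Vec.cast-is-id refl _)) (Vec.toList-injective refl _ _ (begin
    toList (Vec.map not (Vec.reverse w)) ≡⟨ Vec.toList-map not (Vec.reverse w) ⟩
    map not (toList (Vec.reverse w))     ≡⟨ cong (map not) (Vec.toList-reverse w) ⟩
    map not (reverse (toList w))         ≡⟨ cong (map not ∘ reverse) toList-w ⟩
    map not (reverse (true ∷ r))         ≡⟨ anti ⟩
    true ∷ r                             ≡⟨ toList-w ⟨
    toList w                             ∎))
    where open ≡-Reasoning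
  opposite-not : ∀ i → lookup w (opposite i) ≡ not (lookup w i)
  opposite-not i = begin
    lookup w (opposite i)                              ≡⟨ cong (λ v → lookup v (opposite i)) anti-w ⟨
    lookup (Vec.map not (Vec.reverse w)) (opposite i)  ≡⟨ Vec.lookup-map (opposite i) not (Vec.reverse w) ⟩
    not (lookup (Vec.reverse w) (opposite i))          ≡⟨ cong not (lookup-reverse-opposite w i) ⟩
    not (lookup w i)                                   ∎
    where open ≡-Reasoning
  complementary : ∀ i → bit (lookup w i) + bit (lookup w (opposite i)) ≡ 1
  complementary i rewrite opposite-not i = trans (+-comm (bit (lookup w i)) _) (bit-not (lookup w i))

reverseComplement-++-complement : ∀ u → reverse u ≡ u →
  reverseComplement (u ++ map not u) ≡ u ++ map not u
reverseComplement-++-complement u palindrome = begin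
  map not (reverse (u ++ map not u))                     ≡⟨ cong (map not) (List.reverse-++ u (map not u)) ⟩
  map not (reverse (map not u) ++ reverse u)             ≡⟨ List.map-++ not (reverse (map not u)) (reverse u) ⟩
  map not (reverse (map not u)) ++ map not (reverse u)   ≡⟨ cong (λ v → map not v ++ map not (reverse u)) (List.reverse-map not u) ⟨
  map not (map not (reverse u)) ++ map not (reverse u)   ≡⟨ cong (_++ map not (reverse u)) (not-not (reverse u)) ⟩
  reverse u ++ map not (reverse u)                       ≡⟨ cong (λ v → v ++ map not v) palindrome ⟩
  u ++ map not u                                         ∎
  where
  open ≡-Reasoning
  not-not : ∀ v → map not (map not v) ≡ v
  not-not v = trans (sym (List.map-∘ v)) (trans (List.map-cong not-involutive v) (List.map-id v))

alternating : ℕ → List Bool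
alternating zero    = []
alternating (suc k) = true ∷ false ∷ alternating k

length-alternating : ∀ k → length (alternating k) ≡ k + k
length-alternating zero    = refl
length-alternating (suc k) = cong suc (trans (cong suc (length-alternating k)) (sym (+-suc k k)))

val-alternating : ∀ k → 3 * val (alternating k) + 2 ≡ 2 * 2 ^ length (alternating k)
val-alternating zero    = refl
val-alternating (suc k) = begin
  3 * val (true ∷ false ∷ alternating k) + 2 ≡⟨ cong (λ v → 3 * v + 2) (foldl-push 2 (alternating k)) ⟩
  3 * (2 * P + val (alternating k)) + 2      ≡⟨ regroup P (val (alternating k)) ⟩
  6 * P + (3 * val (alternating k) + 2)      ≡⟨ cong (6 * P +_) (val-alternating k) ⟩
  6 * P + 2 * P                              ≡⟨ collect P ⟩
  2 * (2 * (2 * P))                          ∎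
  where
  open ≡-Reasoning
  P = 2 ^ length (alternating k)
  regroup : ∀ p v → 3 * (2 * p + v) + 2 ≡ 6 * p + (3 * v + 2)
  regroup = solve-∀
  collect : ∀ p → 6 * p + 2 * p ≡ 2 * (2 * (2 * p))
  collect = solve-∀

reverseComplement-alternating : ∀ k → reverseComplement (alternating k) ≡ alternating k
reverseComplement-alternating zero    = refl
reverseComplement-alternating (suc k) = begin
  map not (reverse (true ∷ false ∷ alternating k))
    ≡⟨ cong (map not) (List.reverse-++ (true ∷ false ∷ []) (alternating k)) ⟩
  map not (reverse (alternating k) ++ false ∷ true ∷ [])
    ≡⟨ List.map-++ not (reverse (alternating k)) _ ⟩
  map not (reverse (alternating k)) ++ true ∷ false ∷ []
    ≡⟨ cong (_++ true ∷ false ∷ []) (reverseComplement-alternating k) ⟩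
  alternating k ++ true ∷ false ∷ []
    ≡⟨ alternating-∷ʳ k ⟩
  true ∷ false ∷ alternating k ∎
  where
  open ≡-Reasoning
  alternating-∷ʳ : ∀ k → alternating k ++ true ∷ false ∷ [] ≡ true ∷ false ∷ alternating k
  alternating-∷ʳ zero    = refl
  alternating-∷ʳ (suc k) = cong (λ l → true ∷ false ∷ l) (alternating-∷ʳ k)

quotient-identity : ∀ {A B U M L} → A + suc U ≡ suc U * 2 ^ L → 3 * B + 2 ≡ 2 * 2 ^ L →
  suc U ≡ 2 * M → A ≡ 3 * M * B
quotient-identity {A} {B} {U} {M} {L} hA hB hU = +-cancelʳ-≡ (2 * M) _ _ (begin
  A + 2 * M         ≡⟨ cong (A +_) hU ⟨
  A + suc U         ≡⟨ hA ⟩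
  suc U * 2 ^ L     ≡⟨ cong (_* 2 ^ L) hU ⟩
  2 * M * 2 ^ L     ≡⟨ swap M (2 ^ L) ⟩
  M * (2 * 2 ^ L)   ≡⟨ cong (M *_) hB ⟨
  M * (3 * B + 2)   ≡⟨ expand M B ⟩
  3 * M * B + 2 * M ∎)
  where
  open ≡-Reasoning
  swap : ∀ m p → 2 * m * p ≡ m * (2 * p)
  swap = solve-∀
  expand : ∀ m b → m * (3 * b + 2) ≡ 3 * m * b + 2 * m
  expand = solve-∀

quotientOf : List Bool → ℕ
quotientOf r = 3 * suc (val (true ∷ r ++ reverse r))

antipalQuotient-quotientOf : ∀ r → AntipalQuotient (quotientOf r)
antipalQuotient-quotientOf r =
  val (u ++ map not u) , val (alternating (suc a)) ,
  antipalindromic-val (a + suc a) ((r ++ reverse x) ++ map not u) length-A (reverseComplement-++-complement u palindrome) ,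
  antipalindromic-val a (false ∷ alternating a) (length-alternating (suc a)) (reverseComplement-alternating (suc a)) ,
  quotient-identity {M = suc (val w)} {L = length u} (val-++-complement u) val-B suc-val-u
  where
  a = length r
  x = true ∷ r
  w = true ∷ r ++ reverse r
  u = x ++ reverse x
  palindrome : reverse u ≡ u
  palindrome = trans (List.reverse-++ x (reverse x)) (cong (_++ reverse x) (List.reverse-involutive x))
  length-u : length u ≡ suc a + suc a
  length-u = trans (List.length-++ x) (cong (suc a +_) (List.length-reverse x))
  length-A : length (u ++ map not u) ≡ (suc a + suc a) + (suc a + suc a)
  length-A = trans (List.length-++ u) (cong₂ _+_ length-u (trans (List.length-map not u) length-u))
  val-B : 3 * val (alternating (suc a)) + 2 ≡ 2 * 2 ^ length u
  val-B = trans (val-alternating (suc a)) (cong (λ l → 2 * 2 ^ l) (trans (length-alternating (suc a)) (sym length-u)))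
  u≡w∷ʳtrue : u ≡ w ++ true ∷ []
  u≡w∷ʳtrue = begin
    x ++ reverse x                ≡⟨ cong (x ++_) (List.unfold-reverse true r) ⟩
    x ++ (reverse r ++ true ∷ []) ≡⟨ List.++-assoc x (reverse r) (true ∷ []) ⟨
    w ++ true ∷ []                ∎
    where open ≡-Reasoning
  suc-val-u : suc (val u) ≡ 2 * suc (val w)
  suc-val-u = begin
    suc (val u)                  ≡⟨ cong (suc ∘ val) u≡w∷ʳtrue ⟩
    suc (val (w ++ true ∷ []))   ≡⟨ cong suc (val-++ w (true ∷ [])) ⟩
    suc (val w * 2 + 1)          ≡⟨ double (val w) ⟩
    2 * suc (val w)              ∎
    where
    open ≡-Reasoning
    double : ∀ v → suc (v * 2 + 1) ≡ 2 * suc v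
    double = solve-∀

double-injective : ∀ {m n} → m + m ≡ n + n → m ≡ n
double-injective {m} {n} eq with <-cmp m n
... | tri< lt _ _ = ⊥-elim (<-irrefl eq (+-mono-< lt lt))
... | tri≈ _ e _  = e
... | tri> _ _ gt = ⊥-elim (<-irrefl (sym eq) (+-mono-< gt gt))

quotientOf-injective : ∀ {r r'} → quotientOf r ≡ quotientOf r' → r ≡ r'
quotientOf-injective {r} {r'} eq =
  val-true-∷-injective (val-++-injectiveˡ {true ∷ r} {true ∷ r'} {reverse r} {reverse r'} length-reverse eq-val)
  where
  eq-val : val (true ∷ r ++ reverse r) ≡ val (true ∷ r' ++ reverse r')
  eq-val = suc-injective (*-cancelˡ-≡ _ _ 3 eq)
  length-r : length r ≡ length r'
  length-r = double-injective (begin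
    length r + length r             ≡⟨ cong (length r +_) (List.length-reverse r) ⟨
    length r + length (reverse r)   ≡⟨ List.length-++ r ⟨
    length (r ++ reverse r)         ≡⟨ cong length (val-true-∷-injective {r ++ reverse r} {r' ++ reverse r'} eq-val) ⟩
    length (r' ++ reverse r')       ≡⟨ List.length-++ r' ⟩
    length r' + length (reverse r') ≡⟨ cong (length r' +_) (List.length-reverse r') ⟩
    length r' + length r'           ∎)
    where open ≡-Reasoning
  length-reverse : length (reverse r) ≡ length (reverse r')
  length-reverse = trans (List.length-reverse r) (trans length-r (sym (List.length-reverse r')))

quotientOf-bounds : ∀ p t → let c = val (true ∷ p); n = length p + (length t + length t) in
  3 * c * 2 ^ n ≤ quotientOf (p ++ t) × quotientOf (p ++ t) ≤ 3 * suc c * 2 ^ n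
quotientOf-bounds p t =
  ≤-trans (≤-reflexive (*-assoc 3 c (2 ^ n))) (*-monoʳ-≤ 3 (≤-trans lower (n≤1+n _))) ,
  ≤-trans (*-monoʳ-≤ 3 upper) (≤-reflexive (sym (*-assoc 3 (suc c) (2 ^ n))))
  where
  c = val (true ∷ p)
  m = length t
  n = length p + (m + m)
  r = p ++ t
  x = true ∷ r
  w = x ++ reverse r
  R = 2 ^ length (reverse r)
  scale : 2 ^ m * R ≡ 2 ^ n
  scale = begin
    2 ^ m * R                     ≡⟨ cong (λ l → 2 ^ m * 2 ^ l) (trans (List.length-reverse r) (List.length-++ p)) ⟩
    2 ^ m * 2 ^ (length p + m)    ≡⟨ cong (2 ^ m *_) (^-distribˡ-+-* 2 (length p) m) ⟩
    2 ^ m * (2 ^ length p * 2 ^ m) ≡⟨ rearrange (2 ^ m) (2 ^ length p) ⟩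
    2 ^ length p * (2 ^ m * 2 ^ m) ≡⟨ cong (2 ^ length p *_) (^-distribˡ-+-* 2 m m) ⟨
    2 ^ length p * 2 ^ (m + m)    ≡⟨ ^-distribˡ-+-* 2 (length p) (m + m) ⟨
    2 ^ n                         ∎
    where
    open ≡-Reasoning
    rearrange : ∀ a b → a * (b * a) ≡ b * (a * a)
    rearrange = solve-∀
  lower : c * 2 ^ n ≤ val w
  lower = begin
    c * 2 ^ n       ≡⟨ cong (c *_) scale ⟨
    c * (2 ^ m * R) ≡⟨ *-assoc c (2 ^ m) R ⟨
    c * 2 ^ m * R   ≤⟨ *-monoˡ-≤ R (proj₁ (val-++-bounds (true ∷ p) t)) ⟩
    val x * R       ≤⟨ proj₁ (val-++-bounds x (reverse r)) ⟩
    val w           ∎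
    where open ≤-Reasoning
  upper : suc (val w) ≤ suc c * 2 ^ n
  upper = begin
    suc (val w)           ≤⟨ proj₂ (val-++-bounds x (reverse r)) ⟩
    suc (val x) * R       ≤⟨ *-monoˡ-≤ R (proj₂ (val-++-bounds (true ∷ p) t)) ⟩
    suc c * 2 ^ m * R     ≡⟨ *-assoc (suc c) (2 ^ m) R ⟩
    suc c * (2 ^ m * R)   ≡⟨ cong (suc c *_) scale ⟩
    suc c * 2 ^ n         ∎
    where open ≤-Reasoning

within-bit-length : ∀ e n {c d N} → 2 ^ e ≤ c → d < 2 ^ suc e → c * 2 ^ n ≤ N → N ≤ d * 2 ^ n →
  2 ^ (e + n) ≤ N × N < 2 ^ (suc e + n)
within-bit-length e n {c} {d} {N} c-large d-small lower upper =
  (begin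
    2 ^ (e + n)   ≡⟨ ^-distribˡ-+-* 2 e n ⟩
    2 ^ e * 2 ^ n ≤⟨ *-monoˡ-≤ (2 ^ n) c-large ⟩
    c * 2 ^ n     ≤⟨ lower ⟩
    N             ∎) ,
  (begin-strict
    N                  ≤⟨ upper ⟩
    d * 2 ^ n          <⟨ *-monoˡ-< (2 ^ n) {{m^n≢0 2 n}} d-small ⟩
    2 ^ suc e * 2 ^ n  ≡⟨ ^-distribˡ-+-* 2 (suc e) n ⟨
    2 ^ (suc e + n)    ∎)
  where open ≤-Reasoning

words : ℕ → List (List Bool)
words zero    = [] ∷ []
words (suc m) = map (true ∷_) (words m) ++ map (false ∷_) (words m)

length-words : ∀ m → length (words m) ≡ 2 ^ m
length-words zero    = refl
length-words (suc m) = begin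
  length (map (true ∷_) (words m) ++ map (false ∷_) (words m))
    ≡⟨ List.length-++ (map (true ∷_) (words m)) ⟩
  length (map (true ∷_) (words m)) + length (map (false ∷_) (words m))
    ≡⟨ cong₂ _+_ (List.length-map _ (words m)) (List.length-map _ (words m)) ⟩
  length (words m) + length (words m)
    ≡⟨ cong₂ _+_ (length-words m) (trans (length-words m) (sym (+-identityʳ _))) ⟩
  2 * 2 ^ m ∎
  where open ≡-Reasoning

words-length : ∀ m → All (λ t → length t ≡ m) (words m)
words-length zero    = refl All.∷ All.[]
words-length (suc m) = All.++⁺ (extend true) (extend false)
  where
  extend : ∀ b → All (λ t → length t ≡ suc m) (map (b ∷_) (words m))
  extend b = All.map⁺ (All.map (cong suc) (words-length m))

words-unique : ∀ m → Unique (words m)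
words-unique zero    = All.[] AllPairs.∷ AllPairs.[]
words-unique (suc m) =
  Unique.++⁺ (extend true) (extend false) λ (t∈ , f∈) → true≢false t∈ f∈
  where
  extend : ∀ b → Unique (map (b ∷_) (words m))
  extend b = Unique.map⁺ List.∷-injectiveʳ (words-unique m)
  true≢false : ∀ {w} → w ∈ map (true ∷_) (words m) → w ∈ map (false ∷_) (words m) → ⊥
  true≢false t∈ f∈ with ∈-map⁻ (true ∷_) t∈ | ∈-map⁻ (false ∷_) f∈
  ... | _ , _ , refl | _ , _ , ()

AntipalQuotientOfBitLength : ℕ → ℕ → Set
AntipalQuotientOfBitLength i N = (2 ^ (i ∸ 1) ≤ N) × (N < 2 ^ i) × AntipalQuotient N

antipalQuotientsOfBitLength : ∀ p e m → 2 ^ e ≤ 3 * val (true ∷ p) → 3 * suc (val (true ∷ p)) < 2 ^ suc e →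
  ∃[ Ns ] Unique Ns × All (AntipalQuotientOfBitLength (suc e + (length p + (m + m)))) Ns × length Ns ≡ 2 ^ m
antipalQuotientsOfBitLength p e m c-large d-small =
  map (quotientOf ∘ (p ++_)) (words m) ,
  Unique.map⁺ (List.++-cancelˡ p _ _ ∘ quotientOf-injective) (words-unique m) ,
  All.map⁺ (All.map (λ {t} len → subst (λ l → AntipalQuotientOfBitLength (suc e + (length p + (l + l))) _) len (member t))
                    (words-length m)) ,
  trans (List.length-map _ (words m)) (length-words m)
  where
  member : ∀ t → AntipalQuotientOfBitLength (suc e + (length p + (length t + length t))) (quotientOf (p ++ t))
  member t with within-bit-length e _ c-large d-small (proj₁ (quotientOf-bounds p t)) (proj₂ (quotientOf-bounds p t))
  ... | lower , upper = lower , upper , antipalQuotient-quotientOf (p ++ t)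

even-or-odd : ∀ j → ∃[ m ] (j ≡ m + m ⊎ j ≡ suc (m + m))
even-or-odd zero    = 0 , inj₁ refl
even-or-odd (suc j) with even-or-odd j
... | m , inj₁ even = m , inj₂ (cong suc even)
... | m , inj₂ odd  = suc m , inj₁ (trans (cong suc odd) (cong suc (sym (+-suc m m))))

pow-≤-square : ∀ {i} m → i ≤ 7 + (m + m) → 2 ^ i ≤ (12 * 2 ^ m) ^ 2
pow-≤-square {i} m i≤ = begin
  2 ^ i                 ≤⟨ ^-monoʳ-≤ 2 i≤ ⟩
  2 ^ (7 + (m + m))     ≡⟨ ^-distribˡ-+-* 2 7 (m + m) ⟩
  128 * 2 ^ (m + m)     ≤⟨ *-monoˡ-≤ (2 ^ (m + m)) (≤ᵇ⇒≤ 128 144 _) ⟩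
  144 * 2 ^ (m + m)     ≡⟨ cong (144 *_) (^-distribˡ-+-* 2 m m) ⟩
  144 * (2 ^ m * 2 ^ m) ≡⟨ square (2 ^ m) ⟩
  (12 * 2 ^ m) ^ 2      ∎
  where
  open ≤-Reasoning
  square : ∀ q → 144 * (q * q) ≡ 12 * q * (12 * q * 1)
  square = solve-∀

AntipalQuotientsOfBitLength : ℕ → Set
AntipalQuotientsOfBitLength i =
  ∃[ Ns ] Unique Ns × All (AntipalQuotientOfBitLength i) Ns × (2 ^ i ≤ (12 * length Ns) ^ 2)

enough-quotients : ∀ {i} m → i ≤ 7 + (m + m) →
  ∃[ Ns ] Unique Ns × All (AntipalQuotientOfBitLength i) Ns × length Ns ≡ 2 ^ m →
  AntipalQuotientsOfBitLength i
enough-quotients m i≤ (Ns , unique , members , count) =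
  Ns , unique , members , subst (λ l → _ ≤ (12 * l) ^ 2) (sym count) (pow-≤-square m i≤)

-- The prefix 00 puts the quotients in [3·100₂, 3·101₂]·2^(2+2m) ⊆ [2^3, 2^4)·2^(2+2m),
-- the prefix 11 in [3·111₂, 3·1000₂]·2^(2+2m) ⊆ [2^4, 2^5)·2^(2+2m).
antipalQuotientsOfBitLength-6+ : ∀ j → AntipalQuotientsOfBitLength (6 + j)
antipalQuotientsOfBitLength-6+ j with even-or-odd j
... | m , inj₁ refl = enough-quotients m (n≤1+n _)
  (antipalQuotientsOfBitLength (false ∷ false ∷ []) 3 m (≤ᵇ⇒≤ _ _ _) (≤ᵇ⇒≤ _ _ _))
... | m , inj₂ refl = enough-quotients m ≤-refl
  (antipalQuotientsOfBitLength (true ∷ true ∷ []) 4 m (≤ᵇ⇒≤ _ _ _) (≤ᵇ⇒≤ _ _ _))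

theorem15 : ∃[ k ] ∃[ i₀ ] ∀ (i : ℕ) → i₀ ≤ i →
    ∃[ Ns ] Unique Ns ×
      All (λ N → (2 ^ (i ∸ 1) ≤ N) × (N < 2 ^ i) × AntipalQuotient N) Ns ×
      (2 ^ i ≤ (suc k * length Ns) ^ 2)
theorem15 = 11 , 6 , λ i 6≤i →
  subst AntipalQuotientsOfBitLength (m+[n∸m]≡n 6≤i) (antipalQuotientsOfBitLength-6+ (i ∸ 6))
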